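{- For every $n\in\mathbb{N}$, $\;2^n< ah(3,n)\le 3^{n-1}+2.$
   Context: $[3]^n$ is the set of words $x=(x_1,\dots,x_n)$ with $x_i\in\{1,2,3\}$. A combinatorial line is determined by a word $w\in(\{1,2,3\}\cup\{*\})^n$ containing at least one $*$; it consists of the $3$ points $w(1),w(2),w(3)$, where $w(i)$ is obtained from $w$ by replacing every $*$ by $i$. An $r$-coloring of $[3]^n$ is a coloring of all points using exactly $r$ colors. A combinatorial line is rainbow if its 3 points receive 3 pairwise different colors. The anti-Hales–Jewett number $ah(3,n)$ is the least $r$ such that every $r$-coloring of $[3]^n$ contains a rainbow combinatorial line. -}

module Defs where

open import Data.Nat using (ℕ; _≤_; _<_)
open import Data.Fin using (Fin; zero; suc)
open import Data.Maybe using (Maybe; nothing; just; fromMaybe)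
open import Data.Vec using (Vec; map)
open import Data.Vec.Membership.Propositional using (_∈_)
open import Data.Product using (Σ; ∃; _×_)
open import Relation.Binary.PropositionalEquality using (_≡_; _≢_)
open import Relation.Nullary using (¬_)

-- The alphabet [3] = {1,2,3} is encoded as Fin 3 = {0,1,2}.
-- A point of [3]^n.
Point : ℕ → Set
Point n = Vec (Fin 3) n

-- A word over [3] ∪ {*}; `nothing` plays the role of *.
Word : ℕ → Set
Word n = Vec (Maybe (Fin 3)) n

IsLineWord : ∀ {n} → Word n → Set
IsLineWord w = nothing ∈ w

inst : ∀ {n} → Word n → Fin 3 → Point n
inst w i = map (fromMaybe i) w

Rainbow : ∀ {n r} → (Point n → Fin r) → Word n → Set
Rainbow c w =
  (c (inst w zero) ≢ c (inst w (suc zero))) ×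
  (c (inst w zero) ≢ c (inst w (suc (suc zero)))) ×
  (c (inst w (suc zero)) ≢ c (inst w (suc (suc zero))))

-- c uses exactly r colours: it is surjective onto Fin r.
UsesAllColours : ∀ {n r} → (Point n → Fin r) → Set
UsesAllColours {n} {r} c = (k : Fin r) → ∃ λ (x : Point n) → c x ≡ k

HasRainbowLine : ∀ {n r} → (Point n → Fin r) → Set
HasRainbowLine {n} c = ∃ λ (w : Word n) → IsLineWord w × Rainbow c w

Forces : ℕ → ℕ → Set
Forces n r = (c : Point n → Fin r) → UsesAllColours c → HasRainbowLine c

IsAH3 : ℕ → ℕ → Set
IsAH3 n a = (1 ≤ a) × Forces n a × ((r : ℕ) → 1 ≤ r → r < a → ¬ Forces n r)

-- Lower bound: read x ∈ [3]^n as the binary number with digit 1 exactly where xᵢ ≠ 1,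
-- and colour x by that number mod r.  The points w(2) and w(3) of a line have the same
-- digits, so no line is rainbow, and for r ≤ 2^n every colour occurs.
--
-- Upper bound: if c has no rainbow line, split [3]^(m+1) into the slabs x₁ = 1, 2, 3 with
-- colour sets A, B, C.  For each y the points 1y, 2y, 3y form a line, so two of them share
-- a colour.  If A meets B ∪ C and B meets C, then |A ∪ B ∪ C| ≤ |A| + |B| + |C| - 2; if
-- B ∩ C = ∅, the shared colours give A ⊆ B ∪ C; if A misses B ∪ C, they give C ⊆ B.
-- By induction c uses at most 3^(n-1) + 1 colours (one colour when n = 0).
--
-- ah(3,n) exists because there are finitely many colourings, so whether r colours force
-- a rainbow line is decidable.

module Submission where

open import Defs
open import Data.Empty using (⊥-elim)
open import Data.Fin using (Fin; zero; suc; toℕ; _≟_; finToFun; funToFin)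
open import Data.Fin.Patterns using (0F; 1F; 2F)
open import Data.Fin.Properties using (any?; all?; finToFun-funToFin; toℕ-injective; toℕ-fromℕ<; toℕ<n)
open import Data.Fin.Subset using (Subset; inside; outside; _∪_; _∩_; ∣_∣; _∈_; _⊆_; ⁅_⁆; ⊤; Nonempty)
open import Data.Fin.Subset.Properties
  using (nonempty?; x∈p∩q⁺; x∈p∪q⁺; x∈p∪q⁻; x∈⁅x⁆; x∈⁅y⁆⇒x≡y; ∣⁅x⁆∣≡1; ∣⊤∣≡n; p⊆q⇒∣p∣≤∣q∣)
open import Data.Maybe using (Maybe; nothing; just)
import Data.Maybe.Properties as Maybe
open import Data.Nat using (ℕ; zero; suc; _+_; _*_; _∸_; _^_; _≤_; _<_; z≤n; s≤s; _≤?_; _<?_)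
open import Data.Nat.DivMod using (_mod_; m<n⇒m%n≡m)
open import Data.Nat.Properties hiding (_≟_)
open import Data.Nat.Tactic.RingSolver using (solve-∀)
open import Data.Product using (∃; _×_; _,_)
open import Data.Sum using (_⊎_; inj₁; inj₂; [_,_])
open import Data.Vec using (Vec; []; _∷_; map; lookup; tabulate)
open import Data.Vec.Membership.DecPropositional (Maybe.≡-dec (_≟_ {3})) using (_∈?_)
open import Data.Vec.Properties using (map-∘; map-id; tabulate-cong; tabulate∘lookup)
open import Data.Vec.Relation.Unary.Any using (here; there)
open import Function using (id; _∘_)
open import Level using (0ℓ)
open import Relation.Binary.Definitions using (DecidableEquality)
open import Relation.Binary.PropositionalEquality
  using (_≡_; _≢_; refl; sym; trans; cong; subst; _≗_)
open import Relation.Nullary using (¬_; Dec; yes; no; contradiction)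
open import Relation.Nullary.Decidable using (_×-dec_; _⊎-dec_; _→-dec_; ¬?; map′)
open import Relation.Unary using (Pred; Decidable)

∣p∪q∣+∣p∩q∣≡∣p∣+∣q∣ : ∀ {n} (p q : Subset n) → ∣ p ∪ q ∣ + ∣ p ∩ q ∣ ≡ ∣ p ∣ + ∣ q ∣
∣p∪q∣+∣p∩q∣≡∣p∣+∣q∣ []            []            = refl
∣p∪q∣+∣p∩q∣≡∣p∣+∣q∣ (outside ∷ p) (outside ∷ q) = ∣p∪q∣+∣p∩q∣≡∣p∣+∣q∣ p q
∣p∪q∣+∣p∩q∣≡∣p∣+∣q∣ (inside ∷ p)  (outside ∷ q) = cong suc (∣p∪q∣+∣p∩q∣≡∣p∣+∣q∣ p q)
∣p∪q∣+∣p∩q∣≡∣p∣+∣q∣ (outside ∷ p) (inside ∷ q)  =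
  trans (cong suc (∣p∪q∣+∣p∩q∣≡∣p∣+∣q∣ p q)) (sym (+-suc _ _))
∣p∪q∣+∣p∩q∣≡∣p∣+∣q∣ (inside ∷ p)  (inside ∷ q)  =
  cong suc (trans (+-suc _ _) (trans (cong suc (∣p∪q∣+∣p∩q∣≡∣p∣+∣q∣ p q)) (sym (+-suc _ _))))

∣p∪q∣≤∣p∣+∣q∣ : ∀ {n} (p q : Subset n) → ∣ p ∪ q ∣ ≤ ∣ p ∣ + ∣ q ∣
∣p∪q∣≤∣p∣+∣q∣ p q = subst (∣ p ∪ q ∣ ≤_) (∣p∪q∣+∣p∩q∣≡∣p∣+∣q∣ p q) (m≤m+n _ _)

nonempty⇒∣p∣≥1 : ∀ {n} {p : Subset n} → Nonempty p → 1 ≤ ∣ p ∣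
nonempty⇒∣p∣≥1 {p = p} (x , x∈p) =
  subst (_≤ ∣ p ∣) (∣⁅x⁆∣≡1 x) (p⊆q⇒∣p∣≤∣q∣ λ y∈⁅x⁆ → subst (_∈ p) (sym (x∈⁅y⁆⇒x≡y x y∈⁅x⁆)) x∈p)

∪-lub : ∀ {n} {p q r : Subset n} → p ⊆ r → q ⊆ r → p ∪ q ⊆ r
∪-lub {p = p} {q} p⊆r q⊆r x∈p∪q = [ p⊆r , q⊆r ] (x∈p∪q⁻ p q x∈p∪q)

∣p∪[q∪r]∣+2≤∣p∣+[∣q∣+∣r∣] : ∀ {n} (p q r : Subset n) →
  Nonempty (p ∩ (q ∪ r)) → Nonempty (q ∩ r) → ∣ p ∪ (q ∪ r) ∣ + 2 ≤ ∣ p ∣ + (∣ q ∣ + ∣ r ∣)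
∣p∪[q∪r]∣+2≤∣p∣+[∣q∣+∣r∣] p q r p-meets-q∪r q-meets-r = begin
  ∣ p ∪ (q ∪ r) ∣ + 2
    ≤⟨ +-monoʳ-≤ ∣ p ∪ (q ∪ r) ∣ (+-mono-≤ (nonempty⇒∣p∣≥1 p-meets-q∪r) (nonempty⇒∣p∣≥1 q-meets-r)) ⟩
  ∣ p ∪ (q ∪ r) ∣ + (∣ p ∩ (q ∪ r) ∣ + ∣ q ∩ r ∣) ≡⟨ +-assoc ∣ p ∪ (q ∪ r) ∣ _ _ ⟨
  ∣ p ∪ (q ∪ r) ∣ + ∣ p ∩ (q ∪ r) ∣ + ∣ q ∩ r ∣   ≡⟨ cong (_+ ∣ q ∩ r ∣) (∣p∪q∣+∣p∩q∣≡∣p∣+∣q∣ p (q ∪ r)) ⟩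
  ∣ p ∣ + ∣ q ∪ r ∣ + ∣ q ∩ r ∣                   ≡⟨ +-assoc ∣ p ∣ _ _ ⟩
  ∣ p ∣ + (∣ q ∪ r ∣ + ∣ q ∩ r ∣)                 ≡⟨ cong (∣ p ∣ +_) (∣p∪q∣+∣p∩q∣≡∣p∣+∣q∣ q r) ⟩
  ∣ p ∣ + (∣ q ∣ + ∣ r ∣)                         ∎
  where open ≤-Reasoning

m,n≤o⇒m+n≤2*o : ∀ {m n o} → m ≤ o → n ≤ o → m + n ≤ 2 * o
m,n≤o⇒m+n≤2*o {o = o} m≤o n≤o = +-mono-≤ m≤o (≤-trans n≤o (m≤m+n o 0))

TwoAgree : {A : Set} → A → A → A → Set
TwoAgree x y z = x ≡ y ⊎ x ≡ z ⊎ y ≡ z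

TwoAgree-cong : ∀ {A : Set} {x y z x′ y′ z′ : A} →
  x ≡ x′ → y ≡ y′ → z ≡ z′ → TwoAgree x y z → TwoAgree x′ y′ z′
TwoAgree-cong refl refl refl agree = agree

¬pairwise-distinct⇒TwoAgree : ∀ {A : Set} → DecidableEquality A → (x y z : A) →
  ¬ (x ≢ y × x ≢ z × y ≢ z) → TwoAgree x y z
¬pairwise-distinct⇒TwoAgree _≟_ x y z ¬distinct with x ≟ y | x ≟ z | y ≟ z
... | yes x≡y | _       | _       = inj₁ x≡y
... | no _    | yes x≡z | _       = inj₂ (inj₁ x≡z)
... | no _    | no _    | yes y≡z = inj₂ (inj₂ y≡z)
... | no x≢y  | no x≢z  | no y≢z  = ⊥-elim (¬distinct (x≢y , x≢z , y≢z))

slab : ∀ {n} {B : Set} → (Point (suc n) → B) → Fin 3 → Point n → B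
slab c a x = c (a ∷ x)

image : ∀ {n r} → (Point n → Fin r) → Subset r
image {zero}  c = ⁅ c [] ⁆
image {suc n} c = image (slab c 0F) ∪ (image (slab c 1F) ∪ image (slab c 2F))

∈-image : ∀ {n r} (c : Point n → Fin r) x → c x ∈ image c
∈-image {zero}  c []                   = x∈⁅x⁆ (c [])
∈-image {suc n} c (0F ∷ x)             = x∈p∪q⁺ (inj₁ (∈-image (slab c 0F) x))
∈-image {suc n} c (1F ∷ x)             = x∈p∪q⁺ (inj₂ (x∈p∪q⁺ (inj₁ (∈-image (slab c 1F) x))))
∈-image {suc n} c (2F ∷ x)             = x∈p∪q⁺ (inj₂ (x∈p∪q⁺ (inj₂ (∈-image (slab c 2F) x))))

image-⊆ : ∀ {n r} {p : Subset r} (c : Point n → Fin r) → (∀ x → c x ∈ p) → image c ⊆ p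
image-⊆ {zero}  {p = p} c c∈p k∈image = subst (_∈ p) (sym (x∈⁅y⁆⇒x≡y (c []) k∈image)) (c∈p [])
image-⊆ {suc n} c c∈p =
  ∪-lub (image-⊆ (slab c 0F) (c∈p ∘ (0F ∷_)))
        (∪-lub (image-⊆ (slab c 1F) (c∈p ∘ (1F ∷_))) (image-⊆ (slab c 2F) (c∈p ∘ (2F ∷_))))

usesAllColours⇒r≤∣image∣ : ∀ {n r} (c : Point n → Fin r) → UsesAllColours c → r ≤ ∣ image c ∣
usesAllColours⇒r≤∣image∣ {r = r} c onto =
  subst (_≤ ∣ image c ∣) (∣⊤∣≡n r) (p⊆q⇒∣p∣≤∣q∣ {p = ⊤} λ {k} _ →
    let x , cx≡k = onto k in subst (_∈ image c) cx≡k (∈-image c x))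

slab-rainbowFree : ∀ {n r} (c : Point (suc n) → Fin r) a → ¬ HasRainbowLine c → ¬ HasRainbowLine (slab c a)
slab-rainbowFree c a free (w , line , rainbow) = free (just a ∷ w , there line , rainbow)

inst-∗∷ : ∀ {n} (y : Point n) i → inst (nothing ∷ map just y) i ≡ i ∷ y
inst-∗∷ y i = cong (i ∷_) (trans (sym (map-∘ _ just y)) (map-id y))

line-TwoAgree : ∀ {n r} (c : Point n → Fin r) → ¬ HasRainbowLine c → ∀ {w} → IsLineWord w →
  TwoAgree (c (inst w 0F)) (c (inst w 1F)) (c (inst w 2F))
line-TwoAgree c free line = ¬pairwise-distinct⇒TwoAgree _≟_ _ _ _ λ rainbow → free (_ , line , rainbow)

fibre-TwoAgree : ∀ {n r} (c : Point (suc n) → Fin r) → ¬ HasRainbowLine c →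
  ∀ y → TwoAgree (c (0F ∷ y)) (c (1F ∷ y)) (c (2F ∷ y))
fibre-TwoAgree c free y =
  TwoAgree-cong (cong c (inst-∗∷ y 0F)) (cong c (inst-∗∷ y 1F)) (cong c (inst-∗∷ y 2F))
    (line-TwoAgree c free (here refl))

module _ {m r} (c₀ c₁ c₂ : Point m → Fin r) (agree : ∀ y → TwoAgree (c₀ y) (c₁ y) (c₂ y)) where

  open ≤-Reasoning

  private
    A B C : Subset r
    A = image c₀
    B = image c₁
    C = image c₂

  B∩C-empty⇒A⊆B∪C : ¬ Nonempty (B ∩ C) → A ⊆ B ∪ C
  B∩C-empty⇒A⊆B∪C B∩C-empty = image-⊆ c₀ λ y → in-B∪C y (agree y)
    where
    in-B∪C : ∀ y → TwoAgree (c₀ y) (c₁ y) (c₂ y) → c₀ y ∈ B ∪ C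
    in-B∪C y (inj₁ c₀≡c₁)        = x∈p∪q⁺ (inj₁ (subst (_∈ B) (sym c₀≡c₁) (∈-image c₁ y)))
    in-B∪C y (inj₂ (inj₁ c₀≡c₂)) = x∈p∪q⁺ (inj₂ (subst (_∈ C) (sym c₀≡c₂) (∈-image c₂ y)))
    in-B∪C y (inj₂ (inj₂ c₁≡c₂)) =
      ⊥-elim (B∩C-empty (c₁ y , x∈p∩q⁺ (∈-image c₁ y , subst (_∈ C) (sym c₁≡c₂) (∈-image c₂ y))))

  A∩[B∪C]-empty⇒C⊆B : ¬ Nonempty (A ∩ (B ∪ C)) → C ⊆ B
  A∩[B∪C]-empty⇒C⊆B A-apart = image-⊆ c₂ λ y → in-B y (agree y)
    where
    in-B : ∀ y → TwoAgree (c₀ y) (c₁ y) (c₂ y) → c₂ y ∈ B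
    in-B y (inj₁ c₀≡c₁)        = ⊥-elim (A-apart (c₀ y , x∈p∩q⁺ (∈-image c₀ y ,
      x∈p∪q⁺ (inj₁ (subst (_∈ B) (sym c₀≡c₁) (∈-image c₁ y))))))
    in-B y (inj₂ (inj₁ c₀≡c₂)) = ⊥-elim (A-apart (c₀ y , x∈p∩q⁺ (∈-image c₀ y ,
      x∈p∪q⁺ (inj₂ (subst (_∈ C) (sym c₀≡c₂) (∈-image c₂ y))))))
    in-B y (inj₂ (inj₂ c₁≡c₂)) = subst (_∈ B) c₁≡c₂ (∈-image c₁ y)

  three-images-bound : ∀ {b} → ∣ A ∣ ≤ b → ∣ B ∣ ≤ b → ∣ C ∣ ≤ b →
    ∣ A ∪ (B ∪ C) ∣ + 2 ≤ 3 * b ⊎ ∣ A ∪ (B ∪ C) ∣ ≤ 2 * b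
  three-images-bound {b} ∣A∣≤b ∣B∣≤b ∣C∣≤b with nonempty? (A ∩ (B ∪ C)) | nonempty? (B ∩ C)
  ... | no A-apart | _ = inj₂ (begin
    ∣ A ∪ (B ∪ C) ∣   ≤⟨ ∣p∪q∣≤∣p∣+∣q∣ A (B ∪ C) ⟩
    ∣ A ∣ + ∣ B ∪ C ∣ ≤⟨ +-monoʳ-≤ ∣ A ∣ (p⊆q⇒∣p∣≤∣q∣ (∪-lub id (A∩[B∪C]-empty⇒C⊆B A-apart))) ⟩
    ∣ A ∣ + ∣ B ∣     ≤⟨ m,n≤o⇒m+n≤2*o ∣A∣≤b ∣B∣≤b ⟩
    2 * b             ∎)
  ... | yes _ | no B∩C-empty = inj₂ (begin
    ∣ A ∪ (B ∪ C) ∣ ≤⟨ p⊆q⇒∣p∣≤∣q∣ (∪-lub (B∩C-empty⇒A⊆B∪C B∩C-empty) id) ⟩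
    ∣ B ∪ C ∣       ≤⟨ ∣p∪q∣≤∣p∣+∣q∣ B C ⟩
    ∣ B ∣ + ∣ C ∣   ≤⟨ m,n≤o⇒m+n≤2*o ∣B∣≤b ∣C∣≤b ⟩
    2 * b           ∎)
  ... | yes A-meets | yes B-meets-C = inj₁ (begin
    ∣ A ∪ (B ∪ C) ∣ + 2       ≤⟨ ∣p∪[q∪r]∣+2≤∣p∣+[∣q∣+∣r∣] A B C A-meets B-meets-C ⟩
    ∣ A ∣ + (∣ B ∣ + ∣ C ∣)   ≤⟨ +-mono-≤ ∣A∣≤b (m,n≤o⇒m+n≤2*o ∣B∣≤b ∣C∣≤b) ⟩
    3 * b                     ∎)

Searchable : Set → Set₁
Searchable A = ∀ {P : Pred A 0ℓ} → Decidable P → Dec (∃ P)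

search-Maybe : ∀ {A} → Searchable A → Searchable (Maybe A)
search-Maybe search P? = map′
  [ (nothing ,_) , (λ (a , p) → just a , p) ]
  (λ { (nothing , p) → inj₁ p ; (just a , p) → inj₂ (a , p) })
  (P? nothing ⊎-dec search (P? ∘ just))

search-Vec : ∀ {A} → Searchable A → ∀ n → Searchable (Vec A n)
search-Vec search zero    P? = map′ ([] ,_) (λ { ([] , p) → p }) (P? [])
search-Vec search (suc n) P? = map′
  (λ (a , v , p) → a ∷ v , p)
  (λ { (a ∷ v , p) → a , v , p })
  (search λ a → search-Vec search n (P? ∘ (a ∷_)))

hasRainbowLine? : ∀ {n r} (c : Point n → Fin r) → Dec (HasRainbowLine c)
hasRainbowLine? {n} c = search-Vec (search-Maybe any?) n λ w →
  nothing ∈? w ×-dec ¬? (_ ≟ _) ×-dec ¬? (_ ≟ _) ×-dec ¬? (_ ≟ _)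

usesAllColours? : ∀ {n r} (c : Point n → Fin r) → Dec (UsesAllColours c)
usesAllColours? {n} c = all? λ k → search-Vec any? n λ x → c x ≟ k

usesAllColours-cong : ∀ {n r} {c d : Point n → Fin r} → c ≗ d → UsesAllColours c → UsesAllColours d
usesAllColours-cong c≗d onto k = let x , cx≡k = onto k in x , trans (sym (c≗d x)) cx≡k

hasRainbowLine-cong : ∀ {n r} {c d : Point n → Fin r} → c ≗ d → HasRainbowLine c → HasRainbowLine d
hasRainbowLine-cong {c = c} {d} c≗d (w , line , c₀≢c₁ , c₀≢c₂ , c₁≢c₂) =
  w , line , distinct c₀≢c₁ , distinct c₀≢c₂ , distinct c₁≢c₂
  where
  distinct : ∀ {x y} → c x ≢ c y → d x ≢ d y
  distinct cx≢cy dx≡dy = cx≢cy (trans (c≗d _) (trans dx≡dy (sym (c≗d _))))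

-- Fin.^↔→ needs function extensionality, so colourings are enumerated only up to ≗.
index : ∀ {n} → Point n → Fin (3 ^ n)
index x = funToFin (lookup x)

point : ∀ {n} → Fin (3 ^ n) → Point n
point k = tabulate (finToFun k)

point-index : ∀ {n} (x : Point n) → point (index x) ≡ x
point-index x = trans (tabulate-cong (finToFun-funToFin (lookup x))) (tabulate∘lookup x)

colouring : ∀ {n r} → Fin (r ^ 3 ^ n) → Point n → Fin r
colouring t = finToFun t ∘ index

colouring-complete : ∀ {n r} (c : Point n → Fin r) → colouring (funToFin (c ∘ point)) ≗ c
colouring-complete c x = trans (finToFun-funToFin (c ∘ point) (index x)) (cong c (point-index x))

forces? : ∀ n r → Dec (Forces n r)
forces? n r = map′ forces-all forces-enumerated
  (all? λ t → usesAllColours? (colouring t) →-dec hasRainbowLine? (colouring t))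
  where
  forces-all : (∀ t → UsesAllColours (colouring t) → HasRainbowLine (colouring t)) → Forces n r
  forces-all forces c onto = hasRainbowLine-cong (colouring-complete c)
    (forces _ (usesAllColours-cong (sym ∘ colouring-complete c) onto))
  forces-enumerated : Forces n r → ∀ t → UsesAllColours (colouring t) → HasRainbowLine (colouring t)
  forces-enumerated forces t = forces (colouring t)

colourBound : ℕ → ℕ
colourBound zero    = 1
colourBound (suc m) = 3 ^ m + 1

3*colourBound≤colourBound+2 : ∀ m → 3 * colourBound m ≤ colourBound (suc m) + 2
3*colourBound≤colourBound+2 zero    = s≤s (s≤s (s≤s z≤n))
3*colourBound≤colourBound+2 (suc m) = ≤-reflexive (identity (3 ^ m))
  where
  identity : ∀ x → 3 * (x + 1) ≡ 3 * x + 1 + 2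
  identity = solve-∀

2*colourBound≤colourBound : ∀ m → 2 * colourBound m ≤ colourBound (suc m)
2*colourBound≤colourBound zero    = ≤-refl
2*colourBound≤colourBound (suc m) = begin
  2 * (3 ^ m + 1)        ≡⟨ left (3 ^ m) ⟩
  1 + 2 * 3 ^ m + 1      ≤⟨ +-monoˡ-≤ 1 (+-monoˡ-≤ (2 * 3 ^ m) (m^n>0 3 m)) ⟩
  3 ^ m + 2 * 3 ^ m + 1  ≡⟨ right (3 ^ m) ⟩
  3 * 3 ^ m + 1          ∎
  where
  open ≤-Reasoning
  left : ∀ x → 2 * (x + 1) ≡ 1 + 2 * x + 1
  left = solve-∀
  right : ∀ x → x + 2 * x + 1 ≡ 3 * x + 1
  right = solve-∀

rainbowFree⇒∣image∣≤colourBound : ∀ n {r} (c : Point n → Fin r) → ¬ HasRainbowLine c →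
  ∣ image c ∣ ≤ colourBound n
rainbowFree⇒∣image∣≤colourBound zero    c _    = ≤-reflexive (∣⁅x⁆∣≡1 (c []))
rainbowFree⇒∣image∣≤colourBound (suc m) c free =
  [ (λ 3b → +-cancelʳ-≤ 2 _ _ (≤-trans 3b (3*colourBound≤colourBound+2 m)))
  , (λ 2b → ≤-trans 2b (2*colourBound≤colourBound m)) ]
  (three-images-bound (slab c 0F) (slab c 1F) (slab c 2F) (fibre-TwoAgree c free)
    (slab-bound 0F) (slab-bound 1F) (slab-bound 2F))
  where
  slab-bound : ∀ a → ∣ image (slab c a) ∣ ≤ colourBound m
  slab-bound a = rainbowFree⇒∣image∣≤colourBound m (slab c a) (slab-rainbowFree c a free)

colourBound<r⇒forces : ∀ n r → colourBound n < r → Forces n r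
colourBound<r⇒forces n r bound<r c onto with hasRainbowLine? c
... | yes line = line
... | no free   = contradiction
  (≤-trans (usesAllColours⇒r≤∣image∣ c onto) (rainbowFree⇒∣image∣≤colourBound n c free))
  (<⇒≱ bound<r)

colourBound<3^[n∸1]+2 : ∀ n → colourBound n < 3 ^ (n ∸ 1) + 2
colourBound<3^[n∸1]+2 zero    = s≤s (s≤s z≤n)
colourBound<3^[n∸1]+2 (suc m) = +-monoʳ-< (3 ^ m) ≤-refl

binary : ∀ {n} → Point n → ℕ
binary []                  = 0
binary (zero ∷ x)          = binary x
binary {suc n} (suc _ ∷ x) = 2 ^ n + binary x

binary-inst₁≡inst₂ : ∀ {n} (w : Word n) → binary (inst w 1F) ≡ binary (inst w 2F)
binary-inst₁≡inst₂ []                 = refl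
binary-inst₁≡inst₂ (nothing ∷ w)      = cong (_ +_) (binary-inst₁≡inst₂ w)
binary-inst₁≡inst₂ (just zero ∷ w)    = binary-inst₁≡inst₂ w
binary-inst₁≡inst₂ (just (suc _) ∷ w) = cong (_ +_) (binary-inst₁≡inst₂ w)

binary-surjective : ∀ n {k} → k < 2 ^ n → ∃ λ (x : Point n) → binary x ≡ k
binary-surjective zero    {zero}  _           = [] , refl
binary-surjective zero    {suc _} (s≤s ())
binary-surjective (suc n) {k} k<2^[1+n] with k <? 2 ^ n
... | yes k<2^n = let x , x↦k = binary-surjective n k<2^n in 0F ∷ x , x↦k
... | no k≮2^n with m≤n⇒∃[o]m+o≡n (≮⇒≥ k≮2^n)
...   | j , refl = let x , x↦j = binary-surjective n j<2^n in 1F ∷ x , cong (2 ^ n +_) x↦j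
  where
  j<2^n : j < 2 ^ n
  j<2^n = +-cancelˡ-< (2 ^ n) j (2 ^ n)
    (≤-trans k<2^[1+n] (≤-reflexive (cong (2 ^ n +_) (+-identityʳ (2 ^ n)))))

toℕ-mod : ∀ {r} (i : Fin (suc r)) → toℕ i mod suc r ≡ i
toℕ-mod i = toℕ-injective (trans (toℕ-fromℕ< _) (m<n⇒m%n≡m (toℕ<n i)))

r≤2^n⇒¬forces : ∀ n r → 1 ≤ r → r ≤ 2 ^ n → ¬ Forces n r
r≤2^n⇒¬forces n (suc r) _ r≤2^n forces =
  let w , _ , _ , _ , c₁≢c₂ = forces colour onto in c₁≢c₂ (cong (_mod suc r) (binary-inst₁≡inst₂ w))
  where
  colour : Point n → Fin (suc r)
  colour x = binary x mod suc r
  onto : UsesAllColours colour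
  onto i = let x , x↦i = binary-surjective n (≤-trans (toℕ<n i) r≤2^n) in
           x , trans (cong (_mod suc r) x↦i) (toℕ-mod i)

Minimal : Pred ℕ 0ℓ → ℕ → Set
Minimal P a = P a × (∀ r → r < a → ¬ P r)

minimal-or-absent-below : ∀ {P : Pred ℕ 0ℓ} → Decidable P → ∀ N →
  ∃ (Minimal P) ⊎ (∀ r → r < N → ¬ P r)
minimal-or-absent-below P? zero = inj₂ λ _ ()
minimal-or-absent-below P? (suc N) with minimal-or-absent-below P? N
... | inj₁ minimal = inj₁ minimal
... | inj₂ absent with P? N
...   | yes p = inj₁ (N , p , absent)
...   | no ¬p = inj₂ λ r r<1+N → [ absent r , (λ { refl → ¬p }) ] (m<1+n⇒m<n∨m≡n r<1+N)

minimal-witness : ∀ {P : Pred ℕ 0ℓ} → Decidable P → ∀ {N} → P N → ∃ (Minimal P)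
minimal-witness P? {N} p =
  [ id , (λ absent → ⊥-elim (absent N ≤-refl p)) ] (minimal-or-absent-below P? (suc N))

corollary2p3 : (n : ℕ) → ∃ λ (a : ℕ) → IsAH3 n a × (2 ^ n < a) × (a ≤ 3 ^ (n ∸ 1) + 2)
corollary2p3 n =
  let a , (1≤a , forces-a) , below-a = minimal-witness (λ r → 1 ≤? r ×-dec forces? n r) (1≤N , forces-N) in
  a , (1≤a , forces-a , λ r 1≤r r<a forces-r → below-a r r<a (1≤r , forces-r))
    , ≰⇒> (λ a≤2^n → r≤2^n⇒¬forces n a 1≤a a≤2^n forces-a)
    , ≮⇒≥ (λ N<a → below-a N N<a (1≤N , forces-N))
  where
  N : ℕ
  N = 3 ^ (n ∸ 1) + 2
  1≤N : 1 ≤ N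
  1≤N = ≤-trans (s≤s z≤n) (m≤n+m 2 (3 ^ (n ∸ 1)))
  forces-N : Forces n N
  forces-N = colourBound<r⇒forces n N (colourBound<3^[n∸1]+2 n)
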